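{- If $G=K_n$ is the complete graph on $n\ge 2$ vertices, then $\mathrm{fpt}(G)=1$.
   Context: Zero forcing: given a set $B\subseteq V(G)$ of initially blue vertices (all others white), the color change rule allows a blue vertex $b$ to turn a white vertex $w$ blue if $w$ is the unique white neighbor of $b$. $B$ is a zero forcing set if repeated application eventually turns all of $V(G)$ blue. Propagation: set $B^{[0]}=B$ and for $i\ge1$ let $B^{(i)}$ be the set of vertices $u\notin B^{[i-1]}$ such that some $v\in B^{[i-1]}$ has $u$ as its unique neighbor outside $B^{[i-1]}$, and $B^{[i]}=B^{[i-1]}\cup B^{(i)}$; $\mathrm{pt}(G,B)$ is the least $k$ with $B^{[k]}=V(G)$. A set $B$ with $|B|=m\ge1$ is a fault tolerant zero forcing set if every $(m-1)$-subset of $B$ is a zero forcing set; $\mathrm{Z}_t(G)$ is the minimum size of such a set, and a fault tolerant zero forcing set of that size is called minimum. For a fault tolerant zero forcing set $B$, $\mathrm{fpt}(G,B)=\max_{b\in B}\mathrm{pt}(G,B\setminus\{b\})$, and $\mathrm{fpt}(G)=\min\{\mathrm{fpt}(G,B): B \text{ a minimum fault tolerant zero forcing set of } G\}$. -}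

module Defs where

open import Data.Nat using (ℕ; zero; suc; _≤_; _<_)
open import Data.Fin using (Fin)
open import Data.Fin.Subset using (Subset; _∈_; _∉_; _-_; ∣_∣)
open import Data.Product using (Σ; ∃; ∃-syntax; _×_)
open import Data.Sum using (_⊎_)
open import Data.Empty using (⊥)
open import Relation.Nullary using (¬_)
open import Relation.Binary.PropositionalEquality using (_≡_; sym; refl)

record Graph (n : ℕ) : Set₁ where
  field
    Adj     : Fin n → Fin n → Set
    symm    : ∀ {u v} → Adj u v → Adj v u
    irrefl  : ∀ {u} → ¬ Adj u u

open Graph public

complete : (n : ℕ) → Graph n
complete n = record
  { Adj    = λ u v → ¬ (u ≡ v)
  ; symm   = λ p q → p (sym q)
  ; irrefl = λ p → p refl
  }

-- Membership in B^[i] (blue vertices after i propagation steps from B).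
Blue : ∀ {n} → Graph n → Subset n → ℕ → Fin n → Set
Blue G B zero    u = u ∈ B
Blue G B (suc i) u =
  Blue G B i u ⊎
  (¬ Blue G B i u ×
   ∃[ v ] (Blue G B i v × Adj G v u ×
           (∀ w → Adj G v w → ¬ Blue G B i w → w ≡ u)))

AllBlue : ∀ {n} → Graph n → Subset n → ℕ → Set
AllBlue G B k = ∀ u → Blue G B k u

IsZeroForcingSet : ∀ {n} → Graph n → Subset n → Set
IsZeroForcingSet G B = ∃[ k ] AllBlue G B k

IsPT : ∀ {n} → Graph n → Subset n → ℕ → Set
IsPT G B k = AllBlue G B k × (∀ j → j < k → ¬ AllBlue G B j)

-- B (with |B| = m ≥ 1) is fault tolerant: every (m-1)-subset of B,
-- i.e. every B ∖ {b} with b ∈ B, is a zero forcing set.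
IsFTZFS : ∀ {n} → Graph n → Subset n → Set
IsFTZFS G B = (1 ≤ ∣ B ∣) × (∀ b → b ∈ B → IsZeroForcingSet G (B - b))

IsMinFTZFS : ∀ {n} → Graph n → Subset n → Set
IsMinFTZFS G B = IsFTZFS G B × (∀ B′ → IsFTZFS G B′ → ∣ B ∣ ≤ ∣ B′ ∣)

IsFPTSet : ∀ {n} → Graph n → Subset n → ℕ → Set
IsFPTSet G B k =
  (∀ b → b ∈ B → ∃[ kb ] (IsPT G (B - b) kb × kb ≤ k)) ×
  (∃[ b ] (b ∈ B × IsPT G (B - b) k))

IsFPT : ∀ {n} → Graph n → ℕ → Set
IsFPT G k =
  (∃[ B ] (IsMinFTZFS G B × IsFPTSet G B k)) ×
  (∀ B k′ → IsMinFTZFS G B → IsFPTSet G B k′ → k ≤ k′)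

-- In Kₙ a blue vertex sees every white vertex, so while two vertices are white
-- nothing can be forced: a zero forcing set of Kₙ misses at most one vertex.
-- Removing a vertex b from a fault tolerant set B must leave such a set, and b
-- itself is already missing, so B = V(Kₙ). From V ∖ {b} any other vertex forces b
-- in one step, while propagation time 0 is impossible because b is white.
module Submission where

open import Defs
open import Data.Nat using (ℕ; _≤_; zero; suc; z≤n; s≤s)
open import Data.Nat.Properties using (≤-refl; ≤-trans)
open import Data.Fin using (Fin) renaming (zero to fzero; suc to fsuc)
open import Data.Fin.Properties using (_≟_)
open import Data.Fin.Subset using (Subset; _∈_; _∉_; _-_; ∣_∣; ⊤; ⁅_⁆; inside; outside; Nonempty)
open import Data.Fin.Subset.Properties using (_∈?_; ∈⊤; ∣⊤∣≡n; p⊆q⇒∣p∣≤∣q∣; x∈p∧x≢y⇒x∈p-y; p─q⊆p)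
open import Data.Vec using (_∷_; here; there)
open import Data.Product using (∃-syntax; _×_; _,_; proj₁)
open import Data.Sum using (inj₁; inj₂)
open import Function using (_∘_)
open import Relation.Nullary using (¬_; yes; no; contradiction)
open import Relation.Binary.PropositionalEquality using (_≡_; _≢_; refl; sym; subst)

x∉p-x : ∀ {n} (p : Subset n) (x : Fin n) → x ∉ p - x
x∉p-x (_ ∷ p) (fsuc x) (there x∈p-x) = x∉p-x p x x∈p-x

x∉⊤-y⇒x≡y : ∀ {n} {x y : Fin n} → x ∉ ⊤ - y → x ≡ y
x∉⊤-y⇒x≡y {x = x} {y} x∉ with x ≟ y
... | yes x≡y = x≡y
... | no  x≢y = contradiction (x∈p∧x≢y⇒x∈p-y ∈⊤ x≢y) x∉

1≤∣p∣⇒Nonempty : ∀ {n} {p : Subset n} → 1 ≤ ∣ p ∣ → Nonempty p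
1≤∣p∣⇒Nonempty {p = inside  ∷ p} _ = fzero , here
1≤∣p∣⇒Nonempty {p = outside ∷ p} 1≤∣p∣ with 1≤∣p∣⇒Nonempty 1≤∣p∣
... | x , x∈p = fsuc x , there x∈p

2≤n⇒∃≢ : ∀ {n} → 2 ≤ n → (x : Fin n) → ∃[ y ] y ≢ x
2≤n⇒∃≢ (s≤s (s≤s _)) fzero    = fsuc fzero , λ ()
2≤n⇒∃≢ (s≤s (s≤s _)) (fsuc _) = fzero , λ ()

module _ {n} (G : Graph n) where

  AllBlue⇒1≤ : ∀ {B k u} → u ∉ B → AllBlue G B k → 1 ≤ k
  AllBlue⇒1≤ {k = zero}  u∉B allBlue = contradiction (allBlue _) u∉B
  AllBlue⇒1≤ {k = suc _} _   _       = s≤s z≤n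

  IsFPTSet⇒1≤ : ∀ {B k} → IsFPTSet G B k → 1 ≤ k
  IsFPTSet⇒1≤ {B} (_ , b , _ , allBlue , _) = AllBlue⇒1≤ (x∉p-x B b) allBlue

module _ {n : ℕ} where

  private
    Kₙ : Graph n
    Kₙ = complete n

  white-pair-blocks : ∀ {B u w} i → u ≢ w →
    ¬ Blue Kₙ B i u → ¬ Blue Kₙ B i w → ¬ Blue Kₙ B (suc i) u
  white-pair-blocks i _   u∉ _  (inj₁ u∈) = u∉ u∈
  white-pair-blocks i u≢w _  w∉ (inj₂ (_ , v , v∈ , _ , only-u)) =
    u≢w (sym (only-u _ (λ v≡w → w∉ (subst _ v≡w v∈)) w∉))

  white-pair-stays-white : ∀ {B u w} → u ≢ w → u ∉ B → w ∉ B →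
    ∀ i → ¬ Blue Kₙ B i u × ¬ Blue Kₙ B i w
  white-pair-stays-white u≢w u∉ w∉ zero    = u∉ , w∉
  white-pair-stays-white u≢w u∉ w∉ (suc i) with white-pair-stays-white u≢w u∉ w∉ i
  ... | u∉ᵢ , w∉ᵢ = white-pair-blocks i u≢w u∉ᵢ w∉ᵢ
                  , white-pair-blocks i (u≢w ∘ sym) w∉ᵢ u∉ᵢ

  zfs-misses-≤1 : ∀ {B u w} → IsZeroForcingSet Kₙ B → u ∉ B → w ∉ B → u ≡ w
  zfs-misses-≤1 {u = u} {w} (k , allBlue) u∉ w∉ with u ≟ w
  ... | yes u≡w = u≡w
  ... | no  u≢w with white-pair-stays-white u≢w u∉ w∉ k
  ...   | u∉ₖ , _ = contradiction (allBlue u) u∉ₖ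

  ftzfs⇒∈ : ∀ {B} → IsFTZFS Kₙ B → ∀ u → u ∈ B
  ftzfs⇒∈ {B} (1≤∣B∣ , ft) u with u ∈? B | 1≤∣p∣⇒Nonempty 1≤∣B∣
  ... | yes u∈B | _       = u∈B
  ... | no  u∉B | b , b∈B = contradiction (subst (_∈ B) (sym u≡b) b∈B) u∉B
    where
    u≡b : u ≡ b
    u≡b = zfs-misses-≤1 (ft b b∈B) (u∉B ∘ p─q⊆p B ⁅ b ⁆) (x∉p-x B b)

  ⊤-b-pt≡1 : 2 ≤ n → ∀ b → IsPT Kₙ (⊤ - b) 1
  ⊤-b-pt≡1 2≤n b = allBlue₁ , λ { zero _ allBlue₀ → x∉p-x ⊤ b (allBlue₀ b) ; (suc _) (s≤s ()) }
    where
    allBlue₁ : AllBlue Kₙ (⊤ - b) 1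
    allBlue₁ u with u ∈? (⊤ - b)
    ... | yes u∈ = inj₁ u∈
    ... | no  u∉ with x∉⊤-y⇒x≡y u∉ | 2≤n⇒∃≢ 2≤n u
    ...   | refl | v , v≢u =
      inj₂ (u∉ , v , x∈p∧x≢y⇒x∈p-y ∈⊤ v≢u , v≢u , λ _ _ → x∉⊤-y⇒x≡y)

  ⊤-isFTZFS : 2 ≤ n → IsFTZFS Kₙ ⊤
  ⊤-isFTZFS 2≤n =
    subst (1 ≤_) (sym (∣⊤∣≡n n)) (≤-trans (s≤s z≤n) 2≤n) , λ b _ → 1 , proj₁ (⊤-b-pt≡1 2≤n b)

  ⊤-isMinFTZFS : 2 ≤ n → IsMinFTZFS Kₙ ⊤
  ⊤-isMinFTZFS 2≤n = ⊤-isFTZFS 2≤n , λ _ ft → p⊆q⇒∣p∣≤∣q∣ {p = ⊤} (λ {u} _ → ftzfs⇒∈ ft u)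

  ⊤-fpt≡1 : 2 ≤ n → IsFPTSet Kₙ ⊤ 1
  ⊤-fpt≡1 2≤n@(s≤s (s≤s _)) =
    (λ b _ → 1 , ⊤-b-pt≡1 2≤n b , ≤-refl) , fzero , ∈⊤ , ⊤-b-pt≡1 2≤n fzero

proposition5p8 : ∀ (n : ℕ) → 2 ≤ n → IsFPT (complete n) 1
proposition5p8 n 2≤n =
  (⊤ , ⊤-isMinFTZFS 2≤n , ⊤-fpt≡1 2≤n) , λ _ _ _ → IsFPTSet⇒1≤ (complete n)
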